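{- Let $G=\mathbb{Z}^k\oplus\mathbb{Z}/\mu_1\mathbb{Z}\oplus\dots\oplus\mathbb{Z}/\mu_r\mathbb{Z}$ with positive integers $\mu_r\mid\mu_{r-1}\mid\dots\mid\mu_1$, and let $\omega_i=(w_i,\eta_i)\in G$ for $i=1,\dots,n$, where $w_i\in\mathbb{Z}^k$ and $\eta_i=(\eta_{i1},\dots,\eta_{ir})$ with $\eta_{il}\in\mathbb{Z}/\mu_l\mathbb{Z}$. For $j=0,\dots,r$ let $Q_j$ be the $(k+j)\times n$ matrix whose $i$-th column is $(w_i,\eta_{i1},\dots,\eta_{ij})$. Then $G=\langle\omega_1,\dots,\omega_n\rangle$ if and only if the maximal minors (of size $k$) of the integer matrix $Q_0$ generate $\mathbb{Z}$, and for every $j=1,\dots,r$ the maximal minors (of size $k+j$) of $Q_j$, computed after reducing all entries modulo $\mu_j$ (well defined since $\mu_j\mid\mu_l$ for $l\le j$), generate $\mathbb{Z}/\mu_j\mathbb{Z}$. -}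

module Defs where

open import Data.Nat using (ℕ; zero; suc; _+_)
open import Data.Fin using (Fin; zero; suc; toℕ; punchIn; splitAt; inject≤; _<_)
open import Data.Fin.Properties using (toℕ<n)
open import Data.Integer using (ℤ; +_; -_) renaming (_+_ to _+ℤ_; _*_ to _*ℤ_; _-_ to _-ℤ_)
open import Data.Integer.Divisibility using () renaming (_∣_ to _∣ℤ_)
open import Data.List using (List; []; _∷_)
open import Data.Product using (Σ; _×_; _,_; ∃)
open import Data.Sum using (inj₁; inj₂)
open import Relation.Binary.PropositionalEquality using (_≡_)

sumFin : ∀ m → (Fin m → ℤ) → ℤ
sumFin zero    f = + 0
sumFin (suc m) f = f zero +ℤ sumFin m (λ i → f (suc i))

sgn : ℕ → ℤ
sgn zero          = + 1
sgn (suc zero)    = - (+ 1)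
sgn (suc (suc i)) = sgn i

det : ∀ m → (Fin m → Fin m → ℤ) → ℤ
det zero    A = + 1
det (suc m) A = sumFin (suc m) λ c →
  sgn (toℕ c) *ℤ (A zero c *ℤ det m (λ i j → A (suc i) (punchIn c j)))

StrictlyIncreasing : ∀ {m n} → (Fin m → Fin n) → Set
StrictlyIncreasing σ = ∀ {a b} → a < b → σ a < σ b

Selection : ℕ → ℕ → Set
Selection m n = Σ (Fin m → Fin n) StrictlyIncreasing

minor : ∀ {m n} → (Fin m → Fin n → ℤ) → Selection m n → ℤ
minor {m} A (σ , _) = det m (λ a b → A a (σ b))

combo : ∀ {m n} → (Fin m → Fin n → ℤ) → List (Selection m n × ℤ) → ℤ
combo A []             = + 0
combo A ((σ , c) ∷ xs) = c *ℤ minor A σ +ℤ combo A xs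

MinorsGenerateℤ : ∀ {m n} → (Fin m → Fin n → ℤ) → Set
MinorsGenerateℤ {m} {n} A = ∃ λ (xs : List (Selection m n × ℤ)) → combo A xs ≡ + 1

MinorsGenerateMod : ∀ {m n} → ℕ → (Fin m → Fin n → ℤ) → Set
MinorsGenerateMod {m} {n} μ A =
  ∃ λ (xs : List (Selection m n × ℤ)) → (+ μ) ∣ℤ (combo A xs -ℤ + 1)

-- Data: w : Fin n → ℤ^k, η : Fin n → (l : Fin r) → representative in ℤ of η_{il} ∈ ℤ/μ_l
-- Q_0 : k × n matrix, column i is w_i
Q₀ : ∀ {k n} → (Fin n → Fin k → ℤ) → Fin k → Fin n → ℤ
Q₀ w s i = w i s

-- Q_j for j = suc (toℕ l) (1 ≤ j ≤ r): (k + j) × n matrix, column i is (w_i, η_{i1}, …, η_{ij})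
Q : ∀ {k r n} → (Fin n → Fin k → ℤ) → (Fin n → Fin r → ℤ) →
    (l : Fin r) → Fin (k + suc (toℕ l)) → Fin n → ℤ
Q {k} w η l s i with splitAt k s
... | inj₁ a = w i a
... | inj₂ b = η i (inject≤ b (toℕ<n l))

Generates : ∀ {k r n} → (Fin r → ℕ) → (Fin n → Fin k → ℤ) → (Fin n → Fin r → ℤ) → Set
Generates {k} {r} {n} μ w η =
  (x : Fin k → ℤ) (y : Fin r → ℤ) → ∃ λ (c : Fin n → ℤ) →
    ((s : Fin k) → sumFin n (λ i → c i *ℤ w i s) ≡ x s) ×
    ((l : Fin r) → (+ μ l) ∣ℤ (sumFin n (λ i → c i *ℤ η i l) -ℤ y l))

module Submission where

open import Defs
open import Data.Nat using (ℕ; NonZero)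
open import Data.Nat.Divisibility using (_∣_)
open import Data.Fin using (Fin; _≤_)
open import Data.Integer using (ℤ)
open import Data.Product using (_×_)
open import Function.Bundles using (_⇔_)

open import Data.Nat as ℕ using (zero; suc)
import Data.Nat.Properties as ℕ
import Data.Nat.Divisibility as ℕ
open import Data.Fin as Fin using (zero; suc; toℕ; punchIn; splitAt; inject≤; fromℕ<; _↑ˡ_; _↑ʳ_)
import Data.Fin.Properties as Fin
open import Data.Integer using (+_; -[1+_]; -_; _+_; _*_; _-_; 0ℤ; 1ℤ; -1ℤ)
import Data.Integer.Properties as ℤ
import Data.Integer.Divisibility.Signed as Div
open import Data.Integer.Tactic.RingSolver using (solve-∀)
open import Data.Product using (∃; _,_; proj₁; proj₂; map₂)
open import Data.Product.Function.NonDependent.Propositional using (_×-⇔_)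
open import Data.Sum as Sum using (_⊎_; inj₁; inj₂; [_,_]′)
open import Data.Unit using (⊤; tt)
open import Data.List as List using (List; []; _++_)
open import Data.Vec.Functional using (_∷_; tail)
open import Function using (_∘_; id; const)
open import Function.Bundles using (mk⇔; Equivalence)
import Function.Properties.Equivalence as ⇔
open import Level using (0ℓ)
open import Relation.Binary using (tri<; tri≈; tri>)
open import Relation.Binary.PropositionalEquality
open import Relation.Nullary using (yes; no; contradiction)
open import Relation.Unary using (Pred; U; Decidable)

-- Write ℤ/0 for ℤ. The columns of an integer m × n matrix A span (ℤ/μ)^m if and only if its
-- maximal minors generate ℤ/μ. If they do, Cramer's rule puts (minor A σ) · v into the span
-- for every column selection σ, and a combination of minors congruent to 1 yields v itself.
-- Conversely, argue by induction on m: the rows of A below the first span as well, so their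
-- minors generate by induction; and if A c ≡ e₀, the minor of those rows at g is congruent to
-- det [A c | A_g] = Σ_k c_k det [A_k | A_g], where each determinant on the right is, after
-- sorting its columns, zero or a signed maximal minor of A.
--
-- The coordinates of G are those of ℤ^k (to be hit exactly) and the torsion coordinates l
-- (to be hit modulo μ_l), and Q_j consists of the coordinates up to level j. If ω generates
-- G, then, as μ_j divides μ_l for l ≤ j, the columns of Q_j span (ℤ/μ_j)^(k+j). Conversely,
-- solve level by level: a solution c of all the congruences of Q_j modulo μ_j leaves an
-- error divisible by μ_j, which is removed by subtracting μ_j times a solution of the earlier
-- levels for the quotient.

Mat : ℕ → ℕ → Set
Mat m n = Fin m → Fin n → ℤ

infix 4 _≈_mod_
record _≈_mod_ (a b : ℤ) (μ : ℕ) : Set where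
  constructor ≈mod
  field ∣-diff : + μ Div.∣ a - b
open _≈_mod_ using (∣-diff)

≡⇒≈ : ∀ {a b μ} → a ≡ b → a ≈ b mod μ
≡⇒≈ {a} {μ = μ} refl = ≈mod (Div.divides 0ℤ (trans (ℤ.+-inverseʳ a) (sym (ℤ.*-zeroˡ (+ μ)))))

≈⇒≡ : ∀ {a b} → a ≈ b mod 0 → a ≡ b
≈⇒≡ {a} {b} (≈mod 0∣a-b) = ℤ.i-j≡0⇒i≡j a b (Div.0∣⇒≡0 0∣a-b)

≈-trans : ∀ {a b c μ} → a ≈ b mod μ → b ≈ c mod μ → a ≈ c mod μ
≈-trans {a} {b} {c} (≈mod μ∣a-b) (≈mod μ∣b-c) =
  ≈mod (subst (_ Div.∣_) (telescope a b c) (Div.∣m∣n⇒∣m+n μ∣a-b μ∣b-c))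
  where
  telescope : ∀ a b c → (a - b) + (b - c) ≡ a - c
  telescope = solve-∀

≈-+ : ∀ {a b c d μ} → a ≈ b mod μ → c ≈ d mod μ → a + c ≈ b + d mod μ
≈-+ {a} {b} {c} {d} (≈mod μ∣a-b) (≈mod μ∣c-d) =
  ≈mod (subst (_ Div.∣_) (regroup a b c d) (Div.∣m∣n⇒∣m+n μ∣a-b μ∣c-d))
  where
  regroup : ∀ a b c d → (a - b) + (c - d) ≡ (a + c) - (b + d)
  regroup = solve-∀

≈-*ˡ : ∀ k {a b μ} → a ≈ b mod μ → k * a ≈ k * b mod μ
≈-*ˡ k {a} {b} (≈mod μ∣a-b) = ≈mod (subst (_ Div.∣_) (factor k a b) (Div.∣n⇒∣m*n k μ∣a-b))
  where
  factor : ∀ k a b → k * (a - b) ≡ k * a - k * b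
  factor = solve-∀

≈-*ʳ : ∀ k {a b μ} → a ≈ b mod μ → a * k ≈ b * k mod μ
≈-*ʳ k {a} {b} a≈b = subst₂ (_≈_mod _) (ℤ.*-comm k a) (ℤ.*-comm k b) (≈-*ˡ k a≈b)

≈-weaken : ∀ {a b μ ν} → ν ∣ μ → a ≈ b mod μ → a ≈ b mod ν
≈-weaken ν∣μ (≈mod μ∣a-b) = ≈mod (Div.∣-trans (Div.∣ᵤ⇒∣ ν∣μ) μ∣a-b)

sumFin-cong : ∀ {m} {f g : Fin m → ℤ} → (∀ i → f i ≡ g i) → sumFin m f ≡ sumFin m g
sumFin-cong {zero}  f≗g = refl
sumFin-cong {suc m} f≗g = cong₂ _+_ (f≗g zero) (sumFin-cong (f≗g ∘ suc))

sumFin-≈ : ∀ {m μ} {f g : Fin m → ℤ} → (∀ i → f i ≈ g i mod μ) → sumFin m f ≈ sumFin m g mod μ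
sumFin-≈ {zero}  f≈g = ≡⇒≈ refl
sumFin-≈ {suc m} f≈g = ≈-+ (f≈g zero) (sumFin-≈ (f≈g ∘ suc))

sumFin-zero : ∀ m → sumFin m (λ _ → 0ℤ) ≡ 0ℤ
sumFin-zero zero    = refl
sumFin-zero (suc m) = trans (ℤ.+-identityˡ _) (sumFin-zero m)

sumFin-+ : ∀ {m} (f g : Fin m → ℤ) → sumFin m (λ i → f i + g i) ≡ sumFin m f + sumFin m g
sumFin-+ {zero}  f g = refl
sumFin-+ {suc m} f g = trans (cong (_+_ (f zero + g zero)) (sumFin-+ (f ∘ suc) (g ∘ suc)))
                             (interchange (f zero) (g zero) _ _)
  where
  interchange : ∀ a b c d → (a + b) + (c + d) ≡ (a + c) + (b + d)
  interchange = solve-∀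

sumFin-*ˡ : ∀ {m} (a : ℤ) (f : Fin m → ℤ) → sumFin m (λ i → a * f i) ≡ a * sumFin m f
sumFin-*ˡ {zero}  a f = sym (ℤ.*-zeroʳ a)
sumFin-*ˡ {suc m} a f = trans (cong (_+_ (a * f zero)) (sumFin-*ˡ a (f ∘ suc)))
                              (sym (ℤ.*-distribˡ-+ a (f zero) _))

sumFin-*ʳ : ∀ {m} (a : ℤ) (f : Fin m → ℤ) → sumFin m (λ i → f i * a) ≡ sumFin m f * a
sumFin-*ʳ a f = trans (sumFin-cong (λ i → ℤ.*-comm (f i) a)) (trans (sumFin-*ˡ a f) (ℤ.*-comm a _))

sumFin-neg : ∀ {m} (f : Fin m → ℤ) → sumFin m (λ i → - f i) ≡ - sumFin m f
sumFin-neg f = trans (sumFin-cong (λ i → sym (ℤ.-1*i≡-i (f i)))) (trans (sumFin-*ˡ -1ℤ f) (ℤ.-1*i≡-i _))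

sumFin-swap : ∀ m n (f : Fin m → Fin n → ℤ) →
  sumFin m (λ i → sumFin n (f i)) ≡ sumFin n (λ j → sumFin m (λ i → f i j))
sumFin-swap zero    n f = sym (sumFin-zero n)
sumFin-swap (suc m) n f = trans (cong (_+_ (sumFin n (f zero))) (sumFin-swap m n (f ∘ suc)))
                                (sym (sumFin-+ (f zero) _))

sumFin-single : ∀ {m} (f : Fin m → ℤ) i → (∀ j → j ≢ i → f j ≡ 0ℤ) → sumFin m f ≡ f i
sumFin-single {suc m} f zero    f≡0 =
  trans (cong (_+_ (f zero)) (trans (sumFin-cong (λ j → f≡0 (suc j) λ ())) (sumFin-zero m))) (ℤ.+-identityʳ (f zero))
sumFin-single {suc m} f (suc i) f≡0 =
  trans (cong (_+ sumFin m (f ∘ suc)) (f≡0 zero λ ()))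
        (trans (ℤ.+-identityˡ _) (sumFin-single (f ∘ suc) i (λ j j≢i → f≡0 (suc j) (j≢i ∘ Fin.suc-injective))))

infix 8 _·_
_·_ : ∀ {n} → (Fin n → ℤ) → (Fin n → ℤ) → ℤ
_·_ {n} z a = sumFin n (λ k → z k * a k)

·-linear : ∀ {n} c (x y a : Fin n → ℤ) → (λ k → c * x k + y k) · a ≡ c * (x · a) + y · a
·-linear {n} c x y a = begin
    sumFin n (λ k → (c * x k + y k) * a k)
  ≡⟨ sumFin-cong (λ k → trans (ℤ.*-distribʳ-+ (a k) (c * x k) (y k)) (cong (_+ y k * a k) (ℤ.*-assoc c (x k) (a k)))) ⟩
    sumFin n (λ k → c * (x k * a k) + y k * a k)
  ≡⟨ sumFin-+ (λ k → c * (x k * a k)) (λ k → y k * a k) ⟩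
    sumFin n (λ k → c * (x k * a k)) + y · a
  ≡⟨ cong (_+ y · a) (sumFin-*ˡ c (λ k → x k * a k)) ⟩
    c * (x · a) + y · a
  ∎
  where open ≡-Reasoning

·-assoc : ∀ {m n} (a : Fin m → ℤ) (X : Fin m → Fin n → ℤ) (y : Fin n → ℤ) →
  (λ c → sumFin m (λ r → a r * X r c)) · y ≡ sumFin m (λ r → a r * (X r · y))
·-assoc {m} {n} a X y = begin
    sumFin n (λ c → sumFin m (λ r → a r * X r c) * y c)
  ≡⟨ sumFin-cong (λ c → sym (sumFin-*ʳ (y c) (λ r → a r * X r c))) ⟩
    sumFin n (λ c → sumFin m (λ r → a r * X r c * y c))
  ≡⟨ sumFin-swap n m (λ c r → a r * X r c * y c) ⟩
    sumFin m (λ r → sumFin n (λ c → a r * X r c * y c))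
  ≡⟨ sumFin-cong (λ r → trans (sumFin-cong (λ c → ℤ.*-assoc (a r) (X r c) (y c)))
                              (sumFin-*ˡ (a r) (λ c → X r c * y c))) ⟩
    sumFin m (λ r → a r * (X r · y))
  ∎
  where open ≡-Reasoning

δ : ∀ {n} → Fin n → Fin n → ℤ
δ s t with s Fin.≟ t
... | yes _ = 1ℤ
... | no  _ = 0ℤ

δ-· : ∀ {n} (s : Fin n) (a : Fin n → ℤ) → δ s · a ≡ a s
δ-· s a = trans (sumFin-single (λ k → δ s k * a k) s off-diagonal) diagonal
  where
  off-diagonal : ∀ k → k ≢ s → δ s k * a k ≡ 0ℤ
  off-diagonal k k≢s with s Fin.≟ k
  ... | yes s≡k = contradiction (sym s≡k) k≢s
  ... | no  _   = ℤ.*-zeroˡ (a k)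
  diagonal : δ s s * a s ≡ a s
  diagonal with s Fin.≟ s
  ... | yes _   = ℤ.*-identityˡ (a s)
  ... | no  s≢s = contradiction refl s≢s

strike : ∀ {m n} → Mat (suc m) (suc n) → Fin (suc m) → Fin (suc n) → Mat m n
strike M r c i j = M (punchIn r i) (punchIn c j)

det-cong : ∀ m (M N : Mat m m) → (∀ i j → M i j ≡ N i j) → det m M ≡ det m N
det-cong zero    M N M≗N = refl
det-cong (suc m) M N M≗N = sumFin-cong λ c →
  cong₂ (λ x d → sgn (toℕ c) * (x * d)) (M≗N zero c) (det-cong m _ _ (λ i j → M≗N (suc i) (punchIn c j)))

sgn-suc : ∀ i → sgn (suc i) ≡ - sgn i
sgn-suc zero          = refl
sgn-suc (suc zero)    = refl
sgn-suc (suc (suc i)) = sgn-suc i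

sgn-square : ∀ i → sgn i * sgn i ≡ 1ℤ
sgn-square zero          = refl
sgn-square (suc zero)    = refl
sgn-square (suc (suc i)) = sgn-square i

-- On each side exactly one index carries the shifted sign sgn (1 + _), so the terms agree.
signed-sum-exchange : ∀ m (x y : Fin m → ℤ) (D : Fin m → Fin m → ℤ) →
  sumFin m (λ c → sgn (suc (toℕ c)) * (x c * sumFin m (λ r → sgn (toℕ r) * (y r * D r c))))
  ≡ sumFin m (λ r → sgn (suc (toℕ r)) * (y r * sumFin m (λ c → sgn (toℕ c) * (x c * D r c))))
signed-sum-exchange m x y D = begin
    sumFin m (λ c → sgn (suc (toℕ c)) * (x c * sumFin m (λ r → sgn (toℕ r) * (y r * D r c))))
  ≡⟨ sumFin-cong (λ c → distribute (sgn (suc (toℕ c))) (x c) (λ r → sgn (toℕ r) * (y r * D r c))) ⟩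
    sumFin m (λ c → sumFin m (λ r → sgn (suc (toℕ c)) * (x c * (sgn (toℕ r) * (y r * D r c)))))
  ≡⟨ sumFin-swap m m (λ c r → sgn (suc (toℕ c)) * (x c * (sgn (toℕ r) * (y r * D r c)))) ⟩
    sumFin m (λ r → sumFin m (λ c → sgn (suc (toℕ c)) * (x c * (sgn (toℕ r) * (y r * D r c)))))
  ≡⟨ sumFin-cong (λ r → sumFin-cong (λ c → signs (toℕ c) (toℕ r) (x c) (y r) (D r c))) ⟩
    sumFin m (λ r → sumFin m (λ c → sgn (suc (toℕ r)) * (y r * (sgn (toℕ c) * (x c * D r c)))))
  ≡⟨ sumFin-cong (λ r → distribute (sgn (suc (toℕ r))) (y r) (λ c → sgn (toℕ c) * (x c * D r c))) ⟨
    sumFin m (λ r → sgn (suc (toℕ r)) * (y r * sumFin m (λ c → sgn (toℕ c) * (x c * D r c))))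
  ∎
  where
  open ≡-Reasoning
  distribute : ∀ a b (f : Fin m → ℤ) → a * (b * sumFin m f) ≡ sumFin m (λ i → a * (b * f i))
  distribute a b f = sym (trans (sumFin-*ˡ a (λ i → b * f i)) (cong (a *_) (sumFin-*ˡ b f)))
  signs : ∀ c r x y d → sgn (suc c) * (x * (sgn r * (y * d))) ≡ sgn (suc r) * (y * (sgn c * (x * d)))
  signs c r x y d rewrite sgn-suc c | sgn-suc r = ring (sgn c) (sgn r) x y d
    where
    ring : ∀ s t x y d → - s * (x * (t * (y * d))) ≡ - t * (y * (s * (x * d)))
    ring = solve-∀

det-expand-col₀ : ∀ m (M : Mat (suc m) (suc m)) →
  det (suc m) M ≡ sumFin (suc m) (λ r → sgn (toℕ r) * (M r zero * det m (strike M r zero)))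
det-expand-col₀ zero    M = refl
det-expand-col₀ (suc m) M = cong (_+_ (1ℤ * (M zero zero * det (suc m) (strike M zero zero)))) (begin
    sumFin (suc m) (λ c → sgn (suc (toℕ c)) * (M zero (suc c) * det (suc m) (strike M zero (suc c))))
  ≡⟨ sumFin-cong (λ c → cong (λ d → sgn (suc (toℕ c)) * (M zero (suc c) * d))
                              (det-expand-col₀ m (strike M zero (suc c)))) ⟩
    sumFin (suc m) (λ c → sgn (suc (toℕ c)) * (M zero (suc c) * sumFin (suc m) (λ r → sgn (toℕ r) * (M (suc r) zero * D r c))))
  ≡⟨ signed-sum-exchange (suc m) (λ c → M zero (suc c)) (λ r → M (suc r) zero) D ⟩
    sumFin (suc m) (λ r → sgn (suc (toℕ r)) * (M (suc r) zero * sumFin (suc m) (λ c → sgn (toℕ c) * (M zero (suc c) * D r c))))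
  ∎)
  where
  open ≡-Reasoning
  D : Fin (suc m) → Fin (suc m) → ℤ
  D r c = det m (strike (strike M zero zero) r c)

det-transpose : ∀ m (M : Mat m m) → det m (λ i j → M j i) ≡ det m M
det-transpose zero    M = refl
det-transpose (suc m) M = trans
  (sumFin-cong λ r → cong (λ d → sgn (toℕ r) * (M r zero * d)) (det-transpose m (strike M r zero)))
  (sym (det-expand-col₀ m M))

swap₀₁ : ∀ {m} → Fin (suc (suc m)) → Fin (suc (suc m))
swap₀₁ zero          = suc zero
swap₀₁ (suc zero)    = zero
swap₀₁ (suc (suc j)) = suc (suc j)

det-swap₀₁ : ∀ m (M : Mat (suc (suc m)) (suc (suc m))) →
  det (suc (suc m)) (λ i → M i ∘ swap₀₁) ≡ - det (suc (suc m)) M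

-- the terms of the first-row expansion of det-swap₀₁ beyond its first two columns
det-swap₀₁-tail : ∀ m (M : Mat (suc (suc m)) (suc (suc m))) →
  sumFin m (λ c → sgn (toℕ c) * (M zero (suc (suc c)) * det (suc m) (strike (λ i → M i ∘ swap₀₁) zero (suc (suc c)))))
  ≡ - sumFin m (λ c → sgn (toℕ c) * (M zero (suc (suc c)) * det (suc m) (strike M zero (suc (suc c)))))
det-swap₀₁-tail zero    M = refl
det-swap₀₁-tail (suc m) M = trans
  (sumFin-cong λ c → trans
    (cong (λ d → sgn (toℕ c) * (M zero (suc (suc c)) * d))
          (trans (det-cong (suc (suc m)) _ _ (λ i j → cong (M (suc i)) (swap₀₁-punchIn c j)))
                 (det-swap₀₁ m (strike M zero (suc (suc c))))))
    (negate (sgn (toℕ c)) (M zero (suc (suc c))) (det (suc (suc m)) (strike M zero (suc (suc c))))))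
  (sumFin-neg (λ c → sgn (toℕ c) * (M zero (suc (suc c)) * det (suc (suc m)) (strike M zero (suc (suc c))))))
  where
  swap₀₁-punchIn : ∀ {m} (c : Fin (suc m)) j → swap₀₁ (punchIn (suc (suc c)) j) ≡ punchIn (suc (suc c)) (swap₀₁ j)
  swap₀₁-punchIn c zero          = refl
  swap₀₁-punchIn c (suc zero)    = refl
  swap₀₁-punchIn c (suc (suc j)) = refl
  negate : ∀ s a d → s * (a * - d) ≡ - (s * (a * d))
  negate = solve-∀

det-swap₀₁ m M = begin
    det (suc (suc m)) M′
  ≡⟨⟩
    1ℤ * (M zero (suc zero) * det (suc m) (strike M′ zero zero))
      + (-1ℤ * (M zero zero * det (suc m) (strike M′ zero (suc zero))) + T′)
  ≡⟨ cong₂ (λ d₁ d₀ → 1ℤ * (M zero (suc zero) * d₁) + (-1ℤ * (M zero zero * d₀) + T′)) first-minor second-minor ⟩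
    1ℤ * (M zero (suc zero) * D₁) + (-1ℤ * (M zero zero * D₀) + T′)
  ≡⟨ cong (λ t → 1ℤ * (M zero (suc zero) * D₁) + (-1ℤ * (M zero zero * D₀) + t)) (det-swap₀₁-tail m M) ⟩
    1ℤ * (M zero (suc zero) * D₁) + (-1ℤ * (M zero zero * D₀) + - T)
  ≡⟨ ring (M zero (suc zero)) (M zero zero) D₁ D₀ T ⟩
    - (1ℤ * (M zero zero * D₀) + (-1ℤ * (M zero (suc zero) * D₁) + T))
  ≡⟨⟩
    - det (suc (suc m)) M
  ∎
  where
  open ≡-Reasoning
  M′ : Mat (suc (suc m)) (suc (suc m))
  M′ i = M i ∘ swap₀₁
  D₀ = det (suc m) (strike M zero zero)
  D₁ = det (suc m) (strike M zero (suc zero))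
  T  = sumFin m (λ c → sgn (toℕ c) * (M zero (suc (suc c)) * det (suc m) (strike M zero (suc (suc c)))))
  T′ = sumFin m (λ c → sgn (toℕ c) * (M zero (suc (suc c)) * det (suc m) (strike M′ zero (suc (suc c)))))
  first-minor : det (suc m) (strike M′ zero zero) ≡ D₁
  first-minor = det-cong (suc m) (strike M′ zero zero) (strike M zero (suc zero)) λ i → λ { zero → refl ; (suc j) → refl }
  second-minor : det (suc m) (strike M′ zero (suc zero)) ≡ D₀
  second-minor = det-cong (suc m) (strike M′ zero (suc zero)) (strike M zero zero) λ i → λ { zero → refl ; (suc j) → refl }
  ring : ∀ a b d₁ d₀ t → 1ℤ * (a * d₁) + (-1ℤ * (b * d₀) + - t) ≡ - (1ℤ * (b * d₀) + (-1ℤ * (a * d₁) + t))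
  ring = solve-∀

i≡-i⇒i≡0 : ∀ {i} → i ≡ - i → i ≡ 0ℤ
i≡-i⇒i≡0 {+ zero}    _  = refl
i≡-i⇒i≡0 {+ suc _}   ()
i≡-i⇒i≡0 { -[1+ _ ]} ()

cols : ∀ {m n p} → Mat m n → (Fin p → Fin n) → Mat m p
cols B f i j = B i (f j)

det-cols-cong : ∀ {m n} (B : Mat m n) {f g : Fin m → Fin n} → (∀ j → f j ≡ g j) → det m (cols B f) ≡ det m (cols B g)
det-cols-cong {m} B f≗g = det-cong m _ _ (λ i j → cong (B i) (f≗g j))

det-cols-swap₀₁ : ∀ {m n} (B : Mat (suc (suc m)) n) f →
  det (suc (suc m)) (cols B f) ≡ - det (suc (suc m)) (cols B (f ∘ swap₀₁))
det-cols-swap₀₁ {m} B f = sym (trans (cong -_ (det-swap₀₁ m (cols B f))) (ℤ.neg-involutive _))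

det-cols-swap-head : ∀ {m n} (B : Mat (suc (suc m)) n) k (g : Fin (suc m) → Fin n) →
  det (suc (suc m)) (cols B (k ∷ g)) ≡ - det (suc (suc m)) (cols B (g zero ∷ k ∷ tail g))
det-cols-swap-head B k g = trans (det-cols-swap₀₁ B (k ∷ g)) (cong -_ (det-cols-cong B swapped))
  where
  swapped : ∀ j → (k ∷ g) (swap₀₁ j) ≡ (g zero ∷ k ∷ tail g) j
  swapped zero          = refl
  swapped (suc zero)    = refl
  swapped (suc (suc j)) = refl

det-rows : ∀ {m n} (B : Mat n m) (f : Fin m → Fin n) → det m (B ∘ f) ≡ det m (cols (λ i j → B j i) f)
det-rows {m} B f = det-transpose m (cols (λ i j → B j i) f)

-- Quantifying over all B makes these properties of the column maps alone, which is what
-- lets them pass through Laplace expansion along the first column (∷-DetScale).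
DetScale : ∀ {m n} → (Fin m → Fin n) → ℤ → (Fin m → Fin n) → Set
DetScale {m} {n} f ε τ = (B : Mat m n) → det m (cols B f) ≡ ε * det m (cols B τ)

DetVanishes : ∀ {m n} → (Fin m → Fin n) → Set
DetVanishes {m} {n} f = (B : Mat m n) → det m (cols B f) ≡ 0ℤ

∷-DetScale : ∀ {m n} {f τ : Fin m → Fin n} {ε} x → DetScale f ε τ → DetScale (x ∷ f) ε (x ∷ τ)
∷-DetScale {m} {f = f} {τ} {ε} x f~τ B = begin
    det (suc m) (cols B (x ∷ f))
  ≡⟨ det-expand-col₀ m (cols B (x ∷ f)) ⟩
    sumFin (suc m) (λ r → sgn (toℕ r) * (B r x * det m (cols (B ∘ punchIn r) f)))
  ≡⟨ sumFin-cong (λ r → trans (cong (λ d → sgn (toℕ r) * (B r x * d)) (f~τ (B ∘ punchIn r)))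
                              (ring (sgn (toℕ r)) (B r x) ε (det m (cols (B ∘ punchIn r) τ)))) ⟩
    sumFin (suc m) (λ r → ε * (sgn (toℕ r) * (B r x * det m (cols (B ∘ punchIn r) τ))))
  ≡⟨ sumFin-*ˡ ε (λ r → sgn (toℕ r) * (B r x * det m (cols (B ∘ punchIn r) τ))) ⟩
    ε * sumFin (suc m) (λ r → sgn (toℕ r) * (B r x * det m (cols (B ∘ punchIn r) τ)))
  ≡⟨ cong (ε *_) (det-expand-col₀ m (cols B (x ∷ τ))) ⟨
    ε * det (suc m) (cols B (x ∷ τ))
  ∎
  where
  open ≡-Reasoning
  ring : ∀ s b ε d → s * (b * (ε * d)) ≡ ε * (s * (b * d))
  ring = solve-∀

∷-DetVanishes : ∀ {m n} {f : Fin m → Fin n} x → DetVanishes f → DetVanishes (x ∷ f)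
∷-DetVanishes {m} {f = f} x f-vanishes B =
  trans (∷-DetScale {τ = f} {ε = 0ℤ} x (λ B′ → trans (f-vanishes B′) (sym (ℤ.*-zeroˡ (det m (cols B′ f))))) B)
        (ℤ.*-zeroˡ (det (suc m) (cols B (x ∷ f))))

repeated-column-vanishes : ∀ {m n} (f : Fin (suc m) → Fin n) j → f zero ≡ f (suc j) → DetVanishes f
repeated-column-vanishes {suc m} f zero f₀≡f₁ B =
  i≡-i⇒i≡0 (trans (det-cols-swap₀₁ B f) (cong -_ (det-cols-cong B swapped≗f)))
  where
  swapped≗f : ∀ j → f (swap₀₁ j) ≡ f j
  swapped≗f zero          = sym f₀≡f₁
  swapped≗f (suc zero)    = f₀≡f₁
  swapped≗f (suc (suc j)) = refl
repeated-column-vanishes {suc m} {n} f (suc j) f₀≡fⱼ₊₂ B = begin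
    det (suc (suc m)) (cols B f)
  ≡⟨ det-cols-swap₀₁ B f ⟩
    - det (suc (suc m)) (cols B (f ∘ swap₀₁))
  ≡⟨ cong -_ (det-cols-cong B swapped) ⟩
    - det (suc (suc m)) (cols B (f (suc zero) ∷ g))
  ≡⟨ cong -_ (∷-DetVanishes (f (suc zero)) (repeated-column-vanishes g j f₀≡fⱼ₊₂) B) ⟩
    - 0ℤ
  ∎
  where
  open ≡-Reasoning
  g : Fin (suc m) → Fin n
  g = f zero ∷ λ i → f (suc (suc i))
  swapped : ∀ i → f (swap₀₁ i) ≡ (f (suc zero) ∷ g) i
  swapped zero          = refl
  swapped (suc zero)    = refl
  swapped (suc (suc i)) = refl

move-to-front-DetScale : ∀ {m} (r : Fin (suc m)) → DetScale (r ∷ punchIn r) (sgn (toℕ r)) id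
move-to-front-DetScale zero B =
  trans (det-cols-cong B {zero ∷ suc} {id} (λ { zero → refl ; (suc j) → refl })) (sym (ℤ.*-identityˡ _))
move-to-front-DetScale {suc m} (suc r) B = begin
    det (suc (suc m)) (cols B (suc r ∷ punchIn (suc r)))
  ≡⟨ det-cols-swap₀₁ B (suc r ∷ punchIn (suc r)) ⟩
    - det (suc (suc m)) (cols B ((suc r ∷ punchIn (suc r)) ∘ swap₀₁))
  ≡⟨ cong -_ (det-cols-cong B swapped) ⟩
    - det (suc (suc m)) (cols B (zero ∷ suc ∘ (r ∷ punchIn r)))
  ≡⟨ cong -_ (∷-DetScale {f = suc ∘ (r ∷ punchIn r)} {τ = suc} {ε = sgn (toℕ r)} zero
                          (λ B′ → move-to-front-DetScale r (cols B′ suc)) B) ⟩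
    - (sgn (toℕ r) * det (suc (suc m)) (cols B (zero ∷ suc)))
  ≡⟨ cong (λ d → - (sgn (toℕ r) * d)) (det-cols-cong B {zero ∷ suc} {id} (λ { zero → refl ; (suc j) → refl })) ⟩
    - (sgn (toℕ r) * det (suc (suc m)) (cols B id))
  ≡⟨ ℤ.neg-distribˡ-* (sgn (toℕ r)) _ ⟩
    - sgn (toℕ r) * det (suc (suc m)) (cols B id)
  ≡⟨ cong (_* det (suc (suc m)) (cols B id)) (sgn-suc (toℕ r)) ⟨
    sgn (toℕ (suc r)) * det (suc (suc m)) (cols B id)
  ∎
  where
  open ≡-Reasoning
  swapped : ∀ j → (suc r ∷ punchIn (suc r)) (swap₀₁ j) ≡ (zero ∷ suc ∘ (r ∷ punchIn r)) j
  swapped zero          = refl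
  swapped (suc zero)    = refl
  swapped (suc (suc j)) = refl

cofactor : ∀ {m} → Mat (suc m) (suc m) → Fin (suc m) → Fin (suc m) → ℤ
cofactor {m} M r c = sgn (toℕ r) * (sgn (toℕ c) * det m (strike M r c))

-- M ∘ (i ∷ punchIn r) is M with row r replaced by row i and moved to the top, and the sum
-- is its expansion along the first row.
cofactor-· : ∀ {m} (M : Mat (suc m) (suc m)) r i → cofactor M r · M i ≡ sgn (toℕ r) * det (suc m) (M ∘ (i ∷ punchIn r))
cofactor-· {m} M r i =
  trans (sumFin-cong (λ c → ring (sgn (toℕ r)) (sgn (toℕ c)) (det m (strike M r c)) (M i c)))
        (sumFin-*ˡ (sgn (toℕ r)) (λ c → sgn (toℕ c) * (M i c * det m (strike M r c))))
  where
  ring : ∀ s t d x → s * (t * d) * x ≡ s * (t * (x * d))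
  ring = solve-∀

cofactor-·-same-row : ∀ {m} (M : Mat (suc m) (suc m)) r → cofactor M r · M r ≡ det (suc m) M
cofactor-·-same-row {m} M r = begin
    cofactor M r · M r
  ≡⟨ cofactor-· M r r ⟩
    sgn (toℕ r) * det (suc m) (M ∘ (r ∷ punchIn r))
  ≡⟨ cong (sgn (toℕ r) *_) (trans (det-rows M (r ∷ punchIn r)) (move-to-front-DetScale r (λ i j → M j i))) ⟩
    sgn (toℕ r) * (sgn (toℕ r) * det (suc m) (λ i j → M j i))
  ≡⟨ ℤ.*-assoc (sgn (toℕ r)) (sgn (toℕ r)) _ ⟨
    sgn (toℕ r) * sgn (toℕ r) * det (suc m) (λ i j → M j i)
  ≡⟨ cong₂ _*_ (sgn-square (toℕ r)) (det-transpose (suc m) M) ⟩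
    1ℤ * det (suc m) M
  ≡⟨ ℤ.*-identityˡ _ ⟩
    det (suc m) M
  ∎
  where open ≡-Reasoning

cofactor-·-other-row : ∀ {m} (M : Mat (suc m) (suc m)) r i → i ≢ r → cofactor M r · M i ≡ 0ℤ
cofactor-·-other-row {m} M r i i≢r = begin
    cofactor M r · M i
  ≡⟨ cofactor-· M r i ⟩
    sgn (toℕ r) * det (suc m) (M ∘ (i ∷ punchIn r))
  ≡⟨ cong (sgn (toℕ r) *_) (trans (det-rows M (i ∷ punchIn r))
                                  (repeated-column-vanishes (i ∷ punchIn r) _ i-is-punched (λ i j → M j i))) ⟩
    sgn (toℕ r) * 0ℤ
  ≡⟨ ℤ.*-zeroʳ (sgn (toℕ r)) ⟩
    0ℤ
  ∎
  where
  open ≡-Reasoning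
  i-is-punched : i ≡ punchIn r (Fin.punchOut (i≢r ∘ sym))
  i-is-punched = sym (Fin.punchIn-punchOut (i≢r ∘ sym))

InSpan : ∀ {m n} → Mat m n → (Fin m → ℤ) → Set
InSpan {m} {n} A u = ∃ λ (z : Fin n → ℤ) → ∀ i → z · A i ≡ u i

InSpan-≗ : ∀ {m n} {A : Mat m n} {u u′ : Fin m → ℤ} → (∀ i → u i ≡ u′ i) → InSpan A u → InSpan A u′
InSpan-≗ u≗u′ (z , z·A≡u) = z , λ i → trans (z·A≡u i) (u≗u′ i)

InSpan-lincomb : ∀ {m n} {A : Mat m n} {u u′ : Fin m → ℤ} c →
  InSpan A u → InSpan A u′ → InSpan A (λ i → c * u i + u′ i)
InSpan-lincomb {A = A} c (z , z·A≡u) (z′ , z′·A≡u′) =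
  (λ k → c * z k + z′ k) , λ i →
    trans (·-linear c z z′ (A i)) (cong₂ (λ x y → c * x + y) (z·A≡u i) (z′·A≡u′ i))

InSpan-cols : ∀ {m n p} (A : Mat m n) (σ : Fin p → Fin n) {u} → InSpan (cols A σ) u → InSpan A u
InSpan-cols {p = p} A σ {u} (y , y·Aσ≡u) = z , λ i → begin
    z · A i
  ≡⟨ ·-assoc y (δ ∘ σ) (A i) ⟩
    sumFin p (λ b → y b * (δ (σ b) · A i))
  ≡⟨ sumFin-cong (λ b → cong (y b *_) (δ-· (σ b) (A i))) ⟩
    y · cols A σ i
  ≡⟨ y·Aσ≡u i ⟩
    u i
  ∎
  where
  open ≡-Reasoning
  z : Fin _ → ℤ
  z k = sumFin p (λ b → y b * δ (σ b) k)

cramer : ∀ m (M : Mat m m) (v : Fin m → ℤ) → InSpan M (λ i → det m M * v i)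
cramer zero    M v = (λ ()) , λ ()
cramer (suc m) M v = z , λ i → begin
    z · M i
  ≡⟨ ·-assoc v (cofactor M) (M i) ⟩
    sumFin (suc m) (λ r → v r * (cofactor M r · M i))
  ≡⟨ sumFin-single (λ r → v r * (cofactor M r · M i)) i
                   (λ r r≢i → trans (cong (v r *_) (cofactor-·-other-row M r i (r≢i ∘ sym))) (ℤ.*-zeroʳ (v r))) ⟩
    v i * (cofactor M i · M i)
  ≡⟨ cong (v i *_) (cofactor-·-same-row M i) ⟩
    v i * det (suc m) M
  ≡⟨ ℤ.*-comm (v i) _ ⟩
    det (suc m) M * v i
  ∎
  where
  open ≡-Reasoning
  z : Fin (suc m) → ℤ
  z c = sumFin (suc m) (λ r → v r * cofactor M r c)

record Sorting {m n} (f : Fin m → Fin n) : Set where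
  field
    sorted            : Fin m → Fin n
    sorted-increasing : StrictlyIncreasing sorted
    factor            : ℤ
    det-sorted        : DetScale f factor sorted
    sorted-from       : ∀ j → ∃ λ j′ → sorted j ≡ f j′

∷-increasing : ∀ {m n} {k : Fin n} (g : Selection m n) →
  (∀ j → k Fin.< proj₁ g j) → StrictlyIncreasing (k ∷ proj₁ g)
∷-increasing g k<g {zero}  {suc b} _   = k<g b
∷-increasing g k<g {suc a} {suc b} a<b = proj₂ g (ℕ.s<s⁻¹ a<b)

-- Insertion by adjacent column swaps: either k is one of the columns of g, or k ∷ g sorts
-- to a selection of the same columns at the cost of a sign.
insert-sorting : ∀ {m n} (k : Fin n) (g : Selection m n) → DetVanishes (k ∷ proj₁ g) ⊎ Sorting (k ∷ proj₁ g)
insert-sorting {zero} k (g , _) = inj₂ record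
  { sorted            = k ∷ g
  ; sorted-increasing = λ { {zero} {zero} () }
  ; factor            = 1ℤ
  ; det-sorted        = λ B → sym (ℤ.*-identityˡ _)
  ; sorted-from       = λ j → j , refl
  }
insert-sorting {suc m} k (g , g↑) with Fin.<-cmp k (g zero)
... | tri< k<g₀ _ _ = inj₂ record
  { sorted            = k ∷ g
  ; sorted-increasing = ∷-increasing (g , g↑) k<g
  ; factor            = 1ℤ
  ; det-sorted        = λ B → sym (ℤ.*-identityˡ _)
  ; sorted-from       = λ j → j , refl
  }
  where
  k<g : ∀ j → k Fin.< g j
  k<g zero    = k<g₀
  k<g (suc j) = Fin.<-trans k<g₀ (g↑ ℕ.z<s)
... | tri≈ _ k≡g₀ _ = inj₁ (repeated-column-vanishes (k ∷ g) zero k≡g₀)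
... | tri> _ _ g₀<k with insert-sorting k (tail g , λ a<b → g↑ (ℕ.s<s a<b))
...   | inj₁ vanishes = inj₁ λ B →
  trans (det-cols-swap-head B k g) (cong -_ (∷-DetVanishes {f = k ∷ tail g} (g zero) vanishes B))
...   | inj₂ s = inj₂ record
  { sorted            = g zero ∷ sorted
  ; sorted-increasing = ∷-increasing (sorted , sorted-increasing) g₀<sorted
  ; factor            = - factor
  ; det-sorted        = λ B → trans (det-cols-swap-head B k g)
                          (trans (cong -_ (∷-DetScale {f = k ∷ tail g} {sorted} {factor} (g zero) det-sorted B))
                                 (ℤ.neg-distribˡ-* factor _))
  ; sorted-from       = from
  }
  where
  open Sorting s
  g₀<sorted : ∀ j → g zero Fin.< sorted j
  g₀<sorted j with sorted-from j
  ... | zero  , sortedⱼ≡k  = subst (g zero Fin.<_) (sym sortedⱼ≡k) g₀<k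
  ... | suc i , sortedⱼ≡gᵢ = subst (g zero Fin.<_) (sym sortedⱼ≡gᵢ) (g↑ ℕ.z<s)
  from : ∀ j → ∃ λ j′ → (g zero ∷ sorted) j ≡ (k ∷ g) j′
  from zero = suc zero , refl
  from (suc j) with sorted-from j
  ... | zero  , sortedⱼ≡k  = zero , sortedⱼ≡k
  ... | suc i , sortedⱼ≡gᵢ = suc (suc i) , sortedⱼ≡gᵢ

InIdeal : ∀ {m n} → ℕ → Mat m n → ℤ → Set
InIdeal {m} {n} μ A x = ∃ λ (xs : List (Selection m n × ℤ)) → combo A xs ≈ x mod μ

combo-++ : ∀ {m n} (A : Mat m n) xs ys → combo A (xs ++ ys) ≡ combo A xs + combo A ys
combo-++ A []                  ys = sym (ℤ.+-identityˡ (combo A ys))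
combo-++ A ((σ , c) List.∷ xs) ys = trans (cong (_+_ (c * minor A σ)) (combo-++ A xs ys))
                                          (sym (ℤ.+-assoc (c * minor A σ) (combo A xs) (combo A ys)))

combo-scale : ∀ {m n} (A : Mat m n) k xs → combo A (List.map (map₂ (k *_)) xs) ≡ k * combo A xs
combo-scale A k []                  = sym (ℤ.*-zeroʳ k)
combo-scale A k ((σ , c) List.∷ xs) =
  trans (cong (_+_ (k * c * minor A σ)) (combo-scale A k xs)) (ring k c (minor A σ) (combo A xs))
  where
  ring : ∀ k c d r → k * c * d + k * r ≡ k * (c * d + r)
  ring = solve-∀

module _ {m n μ : ℕ} (A : Mat m n) where

  InIdeal-≈ : ∀ {x y} → x ≈ y mod μ → InIdeal μ A x → InIdeal μ A y
  InIdeal-≈ x≈y (xs , xs≈x) = xs , ≈-trans xs≈x x≈y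

  InIdeal-0 : InIdeal μ A 0ℤ
  InIdeal-0 = [] , ≡⇒≈ refl

  InIdeal-+ : ∀ {x y} → InIdeal μ A x → InIdeal μ A y → InIdeal μ A (x + y)
  InIdeal-+ (xs , xs≈x) (ys , ys≈y) = xs ++ ys , ≈-trans (≡⇒≈ (combo-++ A xs ys)) (≈-+ xs≈x ys≈y)

  InIdeal-* : ∀ k {x} → InIdeal μ A x → InIdeal μ A (k * x)
  InIdeal-* k (xs , xs≈x) = List.map (map₂ (k *_)) xs , ≈-trans (≡⇒≈ (combo-scale A k xs)) (≈-*ˡ k xs≈x)

  InIdeal-sum : ∀ {p} (f : Fin p → ℤ) → (∀ k → InIdeal μ A (f k)) → InIdeal μ A (sumFin p f)
  InIdeal-sum {zero}  f _       = InIdeal-0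
  InIdeal-sum {suc p} f f∈ideal = InIdeal-+ (f∈ideal zero) (InIdeal-sum (f ∘ suc) (f∈ideal ∘ suc))

  InIdeal-minor : ∀ σ → InIdeal μ A (minor A σ)
  InIdeal-minor σ = (σ , 1ℤ) List.∷ [] , ≡⇒≈ (trans (ℤ.+-identityʳ (1ℤ * minor A σ)) (ℤ.*-identityˡ (minor A σ)))

InIdeal-det-∷ : ∀ {m n μ} (A : Mat (suc m) n) k (g : Selection m n) →
  InIdeal μ A (det (suc m) (cols A (k ∷ proj₁ g)))
InIdeal-det-∷ A k g with insert-sorting k g
... | inj₁ vanishes = InIdeal-≈ A (≡⇒≈ (sym (vanishes A))) (InIdeal-0 A)
... | inj₂ s        =
  InIdeal-≈ A (≡⇒≈ (sym (det-sorted A))) (InIdeal-* A factor (InIdeal-minor A (sorted , sorted-increasing)))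
  where open Sorting s

-- The columns of A generate ∏_{t ∈ P} ℤ/ν t, where ℤ/0 is ℤ.
Spans : ∀ {I : Set} {n} → (I → Fin n → ℤ) → Pred I 0ℓ → (I → ℕ) → Set
Spans {I} {n} A P ν = (v : I → ℤ) → ∃ λ (c : Fin n → ℤ) → ∀ t → P t → c · A t ≈ v t mod ν t

InSpan-combo : ∀ {m n} (A : Mat m n) xs (v : Fin m → ℤ) → InSpan A (λ i → combo A xs * v i)
InSpan-combo {n = n} A [] v = (λ _ → 0ℤ) , λ i →
  trans (sumFin-cong (λ k → ℤ.*-zeroˡ (A i k))) (trans (sumFin-zero n) (sym (ℤ.*-zeroˡ (v i))))
InSpan-combo {m} A ((σ , c) List.∷ xs) v = InSpan-≗ (λ i → ring c (minor A σ) (combo A xs) (v i))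
  (InSpan-lincomb c (InSpan-cols A (proj₁ σ) (cramer m (cols A (proj₁ σ)) v)) (InSpan-combo A xs v))
  where
  ring : ∀ c d r v → c * (d * v) + r * v ≡ (c * d + r) * v
  ring = solve-∀

minors⇒spans : ∀ {m n μ} (A : Mat m n) → InIdeal μ A 1ℤ → Spans A U (const μ)
minors⇒spans A (xs , xs≈1) v with InSpan-combo A xs v
... | z , z·A≡xs*v = z , λ i _ →
  ≈-trans (≡⇒≈ (z·A≡xs*v i)) (subst (combo A xs * v i ≈_mod _) (ℤ.*-identityˡ (v i)) (≈-*ʳ (v i) xs≈1))

e₀ : ∀ {m} → Fin (suc m) → ℤ
e₀ = 1ℤ ∷ λ _ → 0ℤ

det-col₀-≈-e₀ : ∀ {m μ} (u : Fin (suc m) → ℤ) (B : Mat (suc m) m) → (∀ i → u i ≈ e₀ i mod μ) →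
  det (suc m) (λ i → u i ∷ B i) ≈ det m (tail B) mod μ
det-col₀-≈-e₀ {m} u B u≈e₀ = ≈-trans (≡⇒≈ (det-expand-col₀ m (λ i → u i ∷ B i)))
  (≈-trans (sumFin-≈ (λ r → ≈-*ˡ (sgn (toℕ r)) (≈-*ʳ (D r) (u≈e₀ r))))
           (≡⇒≈ (trans (sumFin-single (λ r → sgn (toℕ r) * (e₀ r * D r)) zero below-first)
                       (trans (ℤ.*-identityˡ (1ℤ * D zero)) (ℤ.*-identityˡ (D zero))))))
  where
  D : Fin (suc m) → ℤ
  D r = det m (B ∘ punchIn r)
  below-first : ∀ r → r ≢ zero → sgn (toℕ r) * (e₀ r * D r) ≡ 0ℤ
  below-first zero    0≢0 = contradiction refl 0≢0
  below-first (suc r) _   = trans (cong (sgn (toℕ (suc r)) *_) (ℤ.*-zeroˡ (D (suc r)))) (ℤ.*-zeroʳ (sgn (toℕ (suc r))))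

det-col₀-linear : ∀ {m n} (A : Mat (suc m) n) (g : Fin m → Fin n) (c : Fin n → ℤ) →
  det (suc m) (λ i → c · A i ∷ cols A g i) ≡ sumFin n (λ k → c k * det (suc m) (cols A (k ∷ g)))
det-col₀-linear {m} {n} A g c = begin
    det (suc m) (λ i → c · A i ∷ cols A g i)
  ≡⟨ det-expand-col₀ m (λ i → c · A i ∷ cols A g i) ⟩
    sumFin (suc m) (λ r → sgn (toℕ r) * (c · A r * D r))
  ≡⟨ sumFin-cong distribute ⟩
    sumFin (suc m) (λ r → sumFin n (λ k → c k * (sgn (toℕ r) * (A r k * D r))))
  ≡⟨ sumFin-swap (suc m) n (λ r k → c k * (sgn (toℕ r) * (A r k * D r))) ⟩
    sumFin n (λ k → sumFin (suc m) (λ r → c k * (sgn (toℕ r) * (A r k * D r))))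
  ≡⟨ sumFin-cong (λ k → trans (sumFin-*ˡ (c k) (λ r → sgn (toℕ r) * (A r k * D r)))
                              (cong (c k *_) (sym (det-expand-col₀ m (cols A (k ∷ g)))))) ⟩
    sumFin n (λ k → c k * det (suc m) (cols A (k ∷ g)))
  ∎
  where
  open ≡-Reasoning
  D : Fin (suc m) → ℤ
  D r = det m (cols (A ∘ punchIn r) g)
  ring : ∀ s c a d → s * (c * a * d) ≡ c * (s * (a * d))
  ring = solve-∀
  distribute : ∀ r → sgn (toℕ r) * (c · A r * D r) ≡ sumFin n (λ k → c k * (sgn (toℕ r) * (A r k * D r)))
  distribute r = trans (cong (sgn (toℕ r) *_) (sym (sumFin-*ʳ (D r) (λ k → c k * A r k))))
                       (trans (sym (sumFin-*ˡ (sgn (toℕ r)) (λ k → c k * A r k * D r)))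
                              (sumFin-cong (λ k → ring (sgn (toℕ r)) (c k) (A r k) (D r))))

InIdeal-tail-minor : ∀ {m n μ} (A : Mat (suc m) n) (c : Fin n → ℤ) → (∀ i → c · A i ≈ e₀ i mod μ) →
  (g : Selection m n) → InIdeal μ A (minor (tail A) g)
InIdeal-tail-minor {m} A c Ac≈e₀ (g , g↑) =
  InIdeal-≈ A (det-col₀-≈-e₀ (λ i → c · A i) (cols A g) Ac≈e₀)
    (InIdeal-≈ A (≡⇒≈ (sym (det-col₀-linear A g c)))
      (InIdeal-sum A (λ k → c k * det (suc m) (cols A (k ∷ g)))
                     (λ k → InIdeal-* A (c k) (InIdeal-det-∷ A k (g , g↑)))))

Spans-tail : ∀ {m n μ} (A : Mat (suc m) n) → Spans A U (const μ) → Spans (tail A) U (const μ)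
Spans-tail A spans v with spans (0ℤ ∷ v)
... | c , c≈0∷v = c , λ t _ → c≈0∷v (suc t) tt

spans⇒minors : ∀ {m n μ} (A : Mat m n) → Spans A U (const μ) → InIdeal μ A 1ℤ
spans⇒minors {zero}  A _ = InIdeal-minor A ((λ ()) , λ { {()} })
spans⇒minors {suc m} {μ = μ} A spans with spans⇒minors (tail A) (Spans-tail A spans) | spans e₀
... | xs , xs≈1 | c , Ac≈e₀ = InIdeal-≈ A xs≈1 (combo-in xs)
  where
  combo-in : ∀ ys → InIdeal μ A (combo (tail A) ys)
  combo-in []                  = InIdeal-0 A
  combo-in ((g , k) List.∷ ys) =
    InIdeal-+ A (InIdeal-* A k (InIdeal-tail-minor A c (λ i → Ac≈e₀ i tt) g)) (combo-in ys)

spans⇔minors : ∀ {m n} μ (A : Mat m n) → Spans A U (const μ) ⇔ MinorsGenerateMod μ A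
spans⇔minors μ A = mk⇔
  (λ spans → let xs , ≈mod μ∣xs-1 = spans⇒minors A spans in xs , Div.∣⇒∣ᵤ μ∣xs-1)
  (λ (xs , μ∣xs-1) → minors⇒spans A (xs , ≈mod (Div.∣ᵤ⇒∣ μ∣xs-1)))

minorsGenerateMod0⇔ℤ : ∀ {m n} (A : Mat m n) → MinorsGenerateMod 0 A ⇔ MinorsGenerateℤ A
minorsGenerateMod0⇔ℤ A = mk⇔
  (λ (xs , 0∣xs-1) → xs , ≈⇒≡ (≈mod (Div.∣ᵤ⇒∣ 0∣xs-1)))
  (λ (xs , xs≡1) → xs , Div.∣⇒∣ᵤ (∣-diff (≡⇒≈ {μ = 0} xs≡1)))

module _ {I : Set} {n : ℕ} {A : I → Fin n → ℤ} where

  Spans-weaken : ∀ {P Q : Pred I 0ℓ} {ν ν′ : I → ℕ} → (∀ t → Q t → P t) → (∀ t → Q t → ν′ t ∣ ν t) →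
    Spans A P ν → Spans A Q ν′
  Spans-weaken Q⊆P ν′∣ν spans v with spans v
  ... | c , c≈v = c , λ t Qt → ≈-weaken (ν′∣ν t Qt) (c≈v t (Q⊆P t Qt))

  quotients : ∀ {Q : Pred I 0ℓ} M (f : I → ℤ) → (∀ t → Q t → + M Div.∣ f t) →
    ∃ λ q → ∀ t → Q t → f t ≡ q t * + M
  quotients {Q} M f M∣f = q , q-spec
    where
    q : I → ℤ
    q t with + M Div.∣? f t
    ... | yes M∣fₜ = Div.quotient M∣fₜ
    ... | no  _    = 0ℤ
    q-spec : ∀ t → Q t → f t ≡ q t * + M
    q-spec t Qt with + M Div.∣? f t
    ... | yes M∣fₜ = Div._∣_.equality M∣fₜ
    ... | no  M∤fₜ = contradiction (M∣f t Qt) M∤fₜ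

  -- Solve modulo M on all of Q; the error is M q, and subtracting M times a solution of the
  -- congruences on P for the target q removes it modulo ν on P while keeping it a multiple of M.
  Spans-extend : ∀ {P Q : Pred I 0ℓ} {ν : I → ℕ} M → (∀ t → Q t → P t ⊎ ν t ≡ M) →
    Spans A P ν → Spans A Q (const M) → Spans A Q ν
  Spans-extend {Q = Q} {ν} M Q⊆P∪M spansP spansQ v with spansQ v
  ... | c₁ , c₁≈v with quotients M (λ t → c₁ · A t - v t) (λ t Qt → ∣-diff (c₁≈v t Qt))
  ...   | q , error≡qM with spansP q
  ...     | c₂ , c₂≈q = c , c≈v
    where
    c : Fin n → ℤ
    c i = - + M * c₂ i + c₁ i
    residual : ∀ t → Q t → c · A t - v t ≡ (c₂ · A t - q t) * - + M
    residual t Qt = begin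
        c · A t - v t
      ≡⟨ cong (_- v t) (·-linear (- + M) c₂ c₁ (A t)) ⟩
        - + M * (c₂ · A t) + c₁ · A t - v t
      ≡⟨ ring (+ M) (c₂ · A t) (c₁ · A t) (v t) ⟩
        - + M * (c₂ · A t) + (c₁ · A t - v t)
      ≡⟨ cong (λ e → - + M * (c₂ · A t) + e) (error≡qM t Qt) ⟩
        - + M * (c₂ · A t) + q t * + M
      ≡⟨ ring′ (+ M) (c₂ · A t) (q t) ⟩
        (c₂ · A t - q t) * - + M
      ∎
      where
      open ≡-Reasoning
      ring : ∀ m x y z → - m * x + y - z ≡ - m * x + (y - z)
      ring = solve-∀
      ring′ : ∀ m x q → - m * x + q * m ≡ (x - q) * - m
      ring′ = solve-∀
    c≈v : ∀ t → Q t → c · A t ≈ v t mod ν t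
    c≈v t Qt with Q⊆P∪M t Qt
    ... | inj₁ Pt   = ≈mod (subst (_ Div.∣_) (sym (residual t Qt)) (Div.∣m⇒∣m*n (- + M) (∣-diff (c₂≈q t Pt))))
    ... | inj₂ νₜ≡M = ≈mod (subst₂ Div._∣_ (cong +_ (sym νₜ≡M)) (sym (residual t Qt))
                                   (Div.∣n⇒∣m*n (c₂ · A t - q t) (Div.∣m⇒∣-m Div.∣-refl)))

record Enumeration {I : Set} (P : Pred I 0ℓ) (J : Set) : Set where
  field
    lift       : J → I
    lower      : ∀ t → P t → J
    lift-P     : ∀ s → P (lift s)
    lift-lower : ∀ t p → lift (lower t p) ≡ t
    lower-lift : ∀ s p → lower (lift s) p ≡ s

module _ {I J : Set} {n : ℕ} {P : Pred I 0ℓ} (P? : Decidable P) (e : Enumeration P J) where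
  open Enumeration e

  Spans-enumeration : (A : I → Fin n → ℤ) (B : J → Fin n → ℤ) → (∀ s i → B s i ≡ A (lift s) i) →
    ∀ M → Spans A P (const M) ⇔ Spans B U (const M)
  Spans-enumeration A B B≡A∘lift M = mk⇔ restrict extend
    where
    c·B≡c·A : ∀ c s → c · B s ≡ c · A (lift s)
    c·B≡c·A c s = sumFin-cong (λ i → cong (c i *_) (B≡A∘lift s i))
    padded : (J → ℤ) → I → ℤ
    padded v t with P? t
    ... | yes p = v (lower t p)
    ... | no  _ = 0ℤ
    padded-lift : ∀ v s → padded v (lift s) ≡ v s
    padded-lift v s with P? (lift s)
    ... | yes p  = cong v (lower-lift s p)
    ... | no  ¬p = contradiction (lift-P s) ¬p
    restrict : Spans A P (const M) → Spans B U (const M)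
    restrict spans v with spans (padded v)
    ... | c , c≈padded = c , λ s _ →
      ≈-trans (≡⇒≈ (c·B≡c·A c s)) (≈-trans (c≈padded (lift s) (lift-P s)) (≡⇒≈ (padded-lift v s)))
    extend : Spans B U (const M) → Spans A P (const M)
    extend spans V with spans (V ∘ lift)
    ... | c , c≈V∘lift = c , λ t p →
      subst (λ t′ → c · A t′ ≈ V t′ mod M) (lift-lower t p)
            (≈-trans (≡⇒≈ (sym (c·B≡c·A c (lower t p)))) (c≈V∘lift (lower t p) tt))

coordinate : ∀ {k r n} → (Fin n → Fin k → ℤ) → (Fin n → Fin r → ℤ) → Fin k ⊎ Fin r → Fin n → ℤ
coordinate w η (inj₁ s) i = w i s
coordinate w η (inj₂ l) i = η i l

modulus : ∀ {k r} → (Fin r → ℕ) → Fin k ⊎ Fin r → ℕ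
modulus μ (inj₁ _) = 0
modulus μ (inj₂ l) = μ l

-- Below (suc (toℕ l)) selects the coordinates that form the rows of Q w η l, and Below 0
-- those of Q₀ w.
Below : ∀ {k r} → ℕ → Pred (Fin k ⊎ Fin r) 0ℓ
Below j (inj₁ _) = ⊤
Below j (inj₂ l) = toℕ l ℕ.< j

below? : ∀ {k r} j → Decidable (Below {k} {r} j)
below? j (inj₁ _) = yes tt
below? j (inj₂ l) = toℕ l ℕ.<? j

Generates⇔Spans : ∀ {k r n} (μ : Fin r → ℕ) (w : Fin n → Fin k → ℤ) (η : Fin n → Fin r → ℤ) →
  Generates μ w η ⇔ Spans (coordinate w η) U (modulus μ)
Generates⇔Spans μ w η = mk⇔ to from
  where
  to : Generates μ w η → Spans (coordinate w η) U (modulus μ)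
  to generates v with generates (v ∘ inj₁) (v ∘ inj₂)
  ... | c , c·w≡x , μ∣c·η-y =
    c , λ { (inj₁ s) _ → ≡⇒≈ (c·w≡x s) ; (inj₂ l) _ → ≈mod (Div.∣ᵤ⇒∣ (μ∣c·η-y l)) }
  from : Spans (coordinate w η) U (modulus μ) → Generates μ w η
  from spans x y with spans [ x , y ]′
  ... | c , c≈v = c , (λ s → ≈⇒≡ (c≈v (inj₁ s) tt)) , (λ l → Div.∣⇒∣ᵤ (∣-diff (c≈v (inj₂ l) tt)))

Q₀-enumeration : ∀ {k r} → Enumeration (Below {k} {r} 0) (Fin k)
Q₀-enumeration = record
  { lift       = inj₁
  ; lower      = λ { (inj₁ s) _ → s ; (inj₂ _) () }
  ; lift-P     = λ _ → tt
  ; lift-lower = λ { (inj₁ s) _ → refl ; (inj₂ _) () }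
  ; lower-lift = λ _ _ → refl
  }

module _ {k r : ℕ} (l : Fin r) where

  levelRow : Fin (k ℕ.+ suc (toℕ l)) → Fin k ⊎ Fin r
  levelRow s = Sum.map₂ (λ b → inject≤ b (Fin.toℕ<n l)) (splitAt k s)

  Q≡coordinate : ∀ {n} (w : Fin n → Fin k → ℤ) (η : Fin n → Fin r → ℤ) s i →
    Q w η l s i ≡ coordinate w η (levelRow s) i
  Q≡coordinate w η s i with splitAt k s
  ... | inj₁ _ = refl
  ... | inj₂ _ = refl

  Q-enumeration : Enumeration (Below {k} {r} (suc (toℕ l))) (Fin (k ℕ.+ suc (toℕ l)))
  Q-enumeration = record
    { lift       = levelRow
    ; lower      = lower
    ; lift-P     = lift-P
    ; lift-lower = lift-lower
    ; lower-lift = lower-lift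
    }
    where
    lower : ∀ t → Below (suc (toℕ l)) t → Fin (k ℕ.+ suc (toℕ l))
    lower (inj₁ s)  _     = s ↑ˡ suc (toℕ l)
    lower (inj₂ l′) l′≤l = k ↑ʳ fromℕ< l′≤l
    lift-P : ∀ s → Below (suc (toℕ l)) (levelRow s)
    lift-P s with splitAt k s
    ... | inj₁ _ = tt
    ... | inj₂ b = subst (ℕ._< suc (toℕ l)) (sym (Fin.toℕ-inject≤ b _)) (Fin.toℕ<n b)
    lift-lower : ∀ t p → levelRow (lower t p) ≡ t
    lift-lower (inj₁ s)  _     = cong (Sum.map₂ _) (Fin.splitAt-↑ˡ k s (suc (toℕ l)))
    lift-lower (inj₂ l′) l′≤l = trans (cong (Sum.map₂ _) (Fin.splitAt-↑ʳ k (suc (toℕ l)) (fromℕ< l′≤l)))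
                                       (cong inj₂ (Fin.toℕ-injective (trans (Fin.toℕ-inject≤ _ _) (Fin.toℕ-fromℕ< l′≤l))))
    lower-lift : ∀ s p → lower (levelRow s) p ≡ s
    lower-lift s p with splitAt k s in split-s
    ... | inj₁ a = trans (cong (Fin.join k _) (sym split-s)) (Fin.join-splitAt k _ s)
    ... | inj₂ b = trans (cong (k ↑ʳ_) (Fin.toℕ-injective (trans (Fin.toℕ-fromℕ< p) (Fin.toℕ-inject≤ b _))))
                         (trans (cong (Fin.join k _) (sym split-s)) (Fin.join-splitAt k _ s))

module _ {k r n : ℕ} (μ : Fin r → ℕ) (w : Fin n → Fin k → ℤ) (η : Fin n → Fin r → ℤ) where

  Q₀-spans⇔ : ∀ M → Spans (coordinate w η) (Below 0) (const M) ⇔ Spans (Q₀ w) U (const M)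
  Q₀-spans⇔ = Spans-enumeration (below? 0) Q₀-enumeration (coordinate w η) (Q₀ w) (λ _ _ → refl)

  Q-spans⇔ : ∀ l M → Spans (coordinate w η) (Below (suc (toℕ l))) (const M) ⇔ Spans (Q w η l) U (const M)
  Q-spans⇔ l = Spans-enumeration (below? _) (Q-enumeration l) (coordinate w η) (Q w η l) (Q≡coordinate l w η)

  Levels : Set
  Levels = Spans (coordinate w η) (Below 0) (const 0) ×
           ((l : Fin r) → Spans (coordinate w η) (Below (suc (toℕ l))) (const (μ l)))

  spans⇔levels : (∀ (a b : Fin r) → a ≤ b → μ b ∣ μ a) → Spans (coordinate w η) U (modulus μ) ⇔ Levels
  spans⇔levels μ-chain = mk⇔ to from
    where
    to : Spans (coordinate w η) U (modulus μ) → Levels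
    to spans = Spans-weaken (λ _ _ → tt) (λ { (inj₁ _) _ → ℕ.∣-refl ; (inj₂ _) () }) spans
             , λ l → Spans-weaken (λ _ _ → tt) (μₗ∣modulus l) spans
      where
      μₗ∣modulus : ∀ l t → Below (suc (toℕ l)) t → μ l ∣ modulus μ t
      μₗ∣modulus l (inj₁ _)  _      = μ l ℕ.∣0
      μₗ∣modulus l (inj₂ l′) l′<1+l = μ-chain l′ l (ℕ.s≤s⁻¹ l′<1+l)
    from : Levels → Spans (coordinate w η) U (modulus μ)
    from (spans₀ , spansₗ) =
      Spans-weaken (λ { (inj₁ _) _ → tt ; (inj₂ l) _ → Fin.toℕ<n l }) (λ _ _ → ℕ.∣-refl) (up-to r ℕ.≤-refl)
      where
      up-to : ∀ j → j ℕ.≤ r → Spans (coordinate w η) (Below j) (modulus μ)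
      up-to zero    _   = Spans-weaken (λ _ Bt → Bt) (λ { (inj₁ _) _ → 0 ℕ.∣0 ; (inj₂ _) () }) spans₀
      up-to (suc j) j<r = Spans-extend (μ l) below-suc-split (up-to j (ℕ.<⇒≤ j<r))
        (subst (λ j′ → Spans (coordinate w η) (Below (suc j′)) (const (μ l))) (Fin.toℕ-fromℕ< j<r) (spansₗ l))
        where
        l : Fin r
        l = fromℕ< j<r
        below-suc-split : ∀ t → Below (suc j) t → Below j t ⊎ modulus μ t ≡ μ l
        below-suc-split (inj₁ _)  _      = inj₁ tt
        below-suc-split (inj₂ l′) l′<1+j with ℕ.m≤n⇒m<n∨m≡n (ℕ.s≤s⁻¹ l′<1+j)
        ... | inj₁ l′<j = inj₁ l′<j
        ... | inj₂ l′≡j = inj₂ (cong μ (Fin.toℕ-injective (trans l′≡j (sym (Fin.toℕ-fromℕ< j<r)))))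

proposition2p8 : (k r n : ℕ) (μ : Fin r → ℕ) → (∀ l → NonZero (μ l)) →
    (∀ (a b : Fin r) → a ≤ b → μ b ∣ μ a) →
    (w : Fin n → Fin k → ℤ) (η : Fin n → Fin r → ℤ) →
    Generates μ w η ⇔
      (MinorsGenerateℤ (Q₀ w) × ((l : Fin r) → MinorsGenerateMod (μ l) (Q w η l)))
proposition2p8 k r n μ _ μ-chain w η =
  ⇔.trans (Generates⇔Spans μ w η) (⇔.trans (spans⇔levels μ w η μ-chain) (free-part ×-⇔ torsion-part))
  where
  free-part : Spans (coordinate w η) (Below 0) (const 0) ⇔ MinorsGenerateℤ (Q₀ w)
  free-part = ⇔.trans (Q₀-spans⇔ μ w η 0) (⇔.trans (spans⇔minors 0 (Q₀ w)) (minorsGenerateMod0⇔ℤ (Q₀ w)))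
  level : ∀ l → Spans (coordinate w η) (Below (suc (toℕ l))) (const (μ l)) ⇔ MinorsGenerateMod (μ l) (Q w η l)
  level l = ⇔.trans (Q-spans⇔ μ w η l (μ l)) (spans⇔minors (μ l) (Q w η l))
  torsion-part : (∀ l → Spans (coordinate w η) (Below (suc (toℕ l))) (const (μ l))) ⇔
                 (∀ l → MinorsGenerateMod (μ l) (Q w η l))
  torsion-part = mk⇔ (λ h l → Equivalence.to (level l) (h l)) (λ h l → Equivalence.from (level l) (h l))
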